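{- Let $X$ and $Y$ be strings, and let $P$ and $P^\star$ be consecutive elements of $\mathcal{P}(X,Y)$ with $P^\star$ immediately after $P$. Let $k^\star_P$ be the least index $k$ with $P[k]<P^\star[k]$ and let $j^\star_P=P^\star[k^\star_P]$. Let $\tilde X$ (resp. $\tilde Y$) be the suffix of $X$ (resp. $Y$) obtained by deleting the shortest prefix of $X$ (resp. $Y$) having $Y[P[1:k^\star_P-1]\circ j^\star_P]$ as a subsequence. Then $P^\star$ equals $P[1:k^\star_P-1]\circ j^\star_P$ followed by the first element of $\mathcal{P}(\tilde X,\tilde Y)$.
   Context: For a sequence $S$, $|S|$ is its length, $S[i]$ its $i$th element, $S[i:i']=S[i]\circ S[i+1]\circ\cdots\circ S[i']$ for $1\le i\le i'+1\le |S|+1$ (empty if $i=i'+1$), and for an index sequence $I=i_1\circ\cdots\circ i_\ell$ with $i_1<\dots<i_\ell$, $S[I]=S[i_1]\circ\cdots\circ S[i_\ell]$. A subsequence is obtained by deleting zero or more elements at arbitrary positions. $L(A,B)$ denotes the length of a longest common subsequence (LCS) of strings $A,B$. For a contiguous subsequence $\tilde X$ of $X$ and a contiguous subsequence $\tilde Y=Y[j':j'']$ of $Y$, an LCS-position sequence of $\tilde X$ and $\tilde Y$ is a sequence $P$ of $L(\tilde X,\tilde Y)$ increasing indices between $j'$ and $j''$ such that $Y[P]$ is an LCS of $\tilde X$ and $\tilde Y$ and, for every $k$ with $1\le k\le L(\tilde X,\tilde Y)$, $Y[j':P[k]]$ is the shortest prefix of $\tilde Y$ having $Y[P[1:k]]$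 as a subsequence. $\mathcal{P}(\tilde X,\tilde Y)$ denotes the sequence of all LCS-position sequences of $\tilde X$ and $\tilde Y$ in lexicographic order (suffixes of $Y$ are regarded as contiguous subsequences $Y[j':|Y|]$ with their original indices). -}

module Defs where

-- Conventions: strings are lists; ALL indices are 0-based
-- (index i of a list is the (i+1)-th element of the paper).

open import Data.Nat using (ℕ; zero; suc; _≤_; _<_; _∸_)
open import Data.List using (List; []; _∷_; length; take; drop)
open import Data.Maybe using (Maybe; just; nothing)
open import Data.Product using (_×_; ∃)
open import Data.List.Relation.Unary.All using (All)
open import Data.List.Relation.Unary.Linked using (Linked)
open import Data.List.Relation.Binary.Sublist.Propositional using (_⊆_)
open import Data.List.Relation.Binary.Lex.Strict using (Lex-<)
open import Relation.Binary.PropositionalEquality using (_≡_)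
open import Relation.Nullary using (¬_)

_!_ : {A : Set} → List A → ℕ → Maybe A
[] ! _ = nothing
(x ∷ xs) ! zero = just x
(x ∷ xs) ! suc n = xs ! n

sel : {A : Set} → List A → List ℕ → Maybe (List A)
sel Y [] = just []
sel Y (i ∷ is) with Y ! i | sel Y is
... | just a | just as = just (a ∷ as)
... | _ | _ = nothing

IsLCS : {A : Set} → List A → List A → List A → Set
IsLCS Z U V = Z ⊆ U × Z ⊆ V ×
  (∀ W → W ⊆ U → W ⊆ V → length W ≤ length Z)

ShortestPrefix : {A : Set} → List A → List A → ℕ → Set
ShortestPrefix S Z m = m ≤ length S × Z ⊆ take m S ×
  (∀ m' → m' < m → ¬ (Z ⊆ take m' S))

-- P is an LCS-position sequence of Xt and the suffix Y[j' : |Y|-1]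
-- of Y (with original indices).
IsLCSPos : {A : Set} → List A → List A → ℕ → List ℕ → Set
IsLCSPos Xt Y j' P =
  All (λ i → j' ≤ i × i < length Y) P ×
  Linked _<_ P ×
  ∃ (λ Z → sel Y P ≡ just Z × IsLCS Z Xt (drop j' Y)) ×
  (∀ k p Z → P ! k ≡ just p → sel Y (take (suc k) P) ≡ just Z →
     ShortestPrefix (drop j' Y) Z (suc p ∸ j'))

_<lex_ : List ℕ → List ℕ → Set
P <lex Q = Lex-< _≡_ _<_ P Q

Consecutive : {A : Set} → List A → List A → ℕ → List ℕ → List ℕ → Set
Consecutive Xt Y j' P P⋆ =
  IsLCSPos Xt Y j' P × IsLCSPos Xt Y j' P⋆ × P <lex P⋆ ×
  (∀ Q → IsLCSPos Xt Y j' Q → ¬ (P <lex Q × Q <lex P⋆))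

IsFirst : {A : Set} → List A → List A → ℕ → List ℕ → Set
IsFirst Xt Y j' Q =
  IsLCSPos Xt Y j' Q × (∀ Q' → IsLCSPos Xt Y j' Q' → ¬ (Q' <lex Q))

IsKStar : List ℕ → List ℕ → ℕ → ℕ → Set
IsKStar P P⋆ k j = ∃ (λ p → P ! k ≡ just p × P⋆ ! k ≡ just j × p < j) ×
  (∀ k' a b → k' < k → P ! k' ≡ just a → P⋆ ! k' ≡ just b → ¬ (a < b))

{-# OPTIONS --safe #-}
module Submission where

-- P⋆ agrees with P before position k, so P⋆ = U ∘ j ∘ Q with U = P[1:k-1], and the greediness of P⋆
-- makes Y[1:j] the shortest prefix of Y containing W = Y[U ∘ j]. Embedding W into the shortest
-- prefixes of X and Y leaves the most room for what follows, so Q is an LCS-position sequence of the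
-- remaining suffixes X̃ and Ỹ, and conversely any such sequence Q' can take the place of Q.
-- A lexicographically smaller Q' would therefore put U ∘ j ∘ Q' strictly between P and P⋆.

open import Data.Empty using (⊥-elim)
open import Data.List using (List; []; _∷_; _++_; [_]; take; drop; length)
open import Data.List.Properties
  using (take++drop≡id; take-take; take-drop; take-all; take-[]; length-drop; ++-assoc; length-++)
open import Data.List.Relation.Binary.Lex.Core using (halt; this; next)
open import Data.List.Relation.Binary.Sublist.Propositional using (_⊆_; []; _∷_; _∷ʳ_; ⊆-trans)
open import Data.List.Relation.Binary.Sublist.Propositional.Properties using (++⁺; take⁺; drop⁺-≥; take-⊆)
open import Data.List.Relation.Unary.All as All using (All; []; _∷_)
import Data.List.Relation.Unary.All.Properties as All
open import Data.List.Relation.Unary.Linked as Linked using (Linked; []; [-]; _∷_)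
open import Data.List.Relation.Unary.Linked.Properties using (Linked⇒All)
open import Data.Maybe using (just; nothing; zipWith)
open import Data.Maybe.Properties using (just-injective)
open import Data.Nat using (ℕ; zero; suc; _+_; _∸_; _≤_; _<_; z≤n; s≤s; _<?_)
open import Data.Nat.Properties
  using (+-identityʳ; +-suc; m+[n∸m]≡n; m∸n+n≡m; m⊓n≤m; m⊓n≤n; ≮⇒≥; <⇒≱; ≤-refl; ≤-antisym; <-trans;
         ∸-monoˡ-≤; +-monoʳ-<; +-monoʳ-≤; +-cancelˡ-≤; m≤n⇒m≤1+n)
open import Data.Product using (_×_; ∃; _,_; proj₁; proj₂)
open import Function using (_∘′_)
open import Relation.Binary.PropositionalEquality
  using (_≡_; refl; sym; trans; cong; subst; subst₂; module ≡-Reasoning)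
open import Relation.Nullary using (¬_; yes; no)
open import Defs

private
  variable
    A : Set
    a b c j j' k m p : ℕ
    s : A
    S T W V Z : List A
    xs ys zs : List ℕ

!-< : S ! k ≡ just s → k < length S
!-< {S = _ ∷ _} {zero} _ = s≤s z≤n
!-< {S = _ ∷ S} {suc k} e = s≤s (!-< {S = S} {k} e)

!-++ˡ : (S : List A) → k < length S → (S ++ T) ! k ≡ S ! k
!-++ˡ {k = zero} (_ ∷ _) _ = refl
!-++ˡ {k = suc k} (_ ∷ S) (s≤s k<) = !-++ˡ S k<

!-++ʳ : (S : List A) → (S ++ T) ! (k + length S) ≡ T ! k
!-++ʳ {k = k} [] rewrite +-identityʳ k = refl
!-++ʳ {k = k} (_ ∷ S) rewrite +-suc k (length S) = !-++ʳ S

!-split : S ! k ≡ just s → S ≡ take k S ++ s ∷ drop (suc k) S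
!-split {S = _ ∷ _} {zero} refl = refl
!-split {S = s' ∷ S} {suc k} e = cong (s' ∷_) (!-split {S = S} {k} e)

All-! : {R : A → Set} → All R S → S ! k ≡ just s → R s
All-! {k = zero} (r ∷ _) refl = r
All-! {k = suc k} (_ ∷ rs) e = All-! rs e

take-++ˡ : (S : List A) → m ≤ length S → take m (S ++ T) ≡ take m S
take-++ˡ {m = zero} S _ = refl
take-++ˡ {m = suc m} (s ∷ S) (s≤s m≤) = cong (s ∷_) (take-++ˡ S m≤)

take-++ʳ : (S : List A) → take (m + length S) (S ++ T) ≡ S ++ take m T
take-++ʳ {m = m} [] rewrite +-identityʳ m = refl
take-++ʳ {m = m} (s ∷ S) rewrite +-suc m (length S) = cong (s ∷_) (take-++ʳ S)

take-+ : (a : ℕ) (S : List A) → take (a + b) S ≡ take a S ++ take b (drop a S)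
take-+ zero S = refl
take-+ {b = b} (suc a) [] = sym (take-[] b)
take-+ (suc a) (s ∷ S) = cong (s ∷_) (take-+ a S)

drop-take : a ≤ c → (S : List A) → drop a (take c S) ≡ take (c ∸ a) (drop a S)
drop-take {a} {c} a≤c S = begin
  drop a (take c S)               ≡⟨ cong (λ n → drop a (take n S)) (sym (m+[n∸m]≡n a≤c)) ⟩
  drop a (take (a + (c ∸ a)) S)   ≡⟨ sym (take-drop (c ∸ a) a S) ⟩
  take (c ∸ a) (drop a S)         ∎
  where open ≡-Reasoning

sel-++ : (Y : List A) (xs ys : List ℕ) → sel Y (xs ++ ys) ≡ zipWith _++_ (sel Y xs) (sel Y ys)
sel-++ Y [] ys with sel Y ys
... | just _ = refl
... | nothing = refl
sel-++ Y (i ∷ xs) ys rewrite sel-++ Y xs ys with Y ! i | sel Y xs | sel Y ys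
... | just _ | just _ | just _ = refl
... | just _ | just _ | nothing = refl
... | just _ | nothing | _ = refl
... | nothing | _ | _ = refl

sel-++⁺ : (Y : List A) (xs ys : List ℕ) → sel Y xs ≡ just W → sel Y ys ≡ just V →
          sel Y (xs ++ ys) ≡ just (W ++ V)
sel-++⁺ Y xs ys sW sV rewrite sel-++ Y xs ys | sW | sV = refl

sel-++⁻ʳ : (Y : List A) (xs ys : List ℕ) → sel Y xs ≡ just W → sel Y (xs ++ ys) ≡ just Z →
           ∃ λ V → sel Y ys ≡ just V × Z ≡ W ++ V
sel-++⁻ʳ Y xs ys sW sZ with sel Y xs | sel Y ys | sel-++ Y xs ys
sel-++⁻ʳ Y xs ys refl sZ | just _ | just V | e = V , refl , just-injective (trans (sym sZ) e)
sel-++⁻ʳ Y xs ys refl sZ | just _ | nothing | e with () ← trans (sym e) sZ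

⊆-++-split : (W : List A) → W ++ V ⊆ S → ∃ λ a → W ⊆ take a S × V ⊆ drop a S
⊆-++-split [] τ = 0 , [] , τ
⊆-++-split (w ∷ W) (y ∷ʳ τ) with a , σ , ρ ← ⊆-++-split (w ∷ W) τ = suc a , y ∷ʳ σ , ρ
⊆-++-split (w ∷ W) (e ∷ τ) with a , σ , ρ ← ⊆-++-split W τ = suc a , e ∷ σ , ρ

⊆-take++drop : (a : ℕ) → W ⊆ take a S → V ⊆ drop a S → W ++ V ⊆ S
⊆-take++drop {S = S} a σ ρ = subst (_ ⊆_) (take++drop≡id a S) (++⁺ σ ρ)

take-take-⊆ˡ : (a c : ℕ) (S : List A) → take a (take c S) ⊆ take a S
take-take-⊆ˡ a c S = subst (_⊆ take a S) (sym (take-take a c S)) (take⁺ (m⊓n≤m a c))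

take-take-⊆ʳ : (a c : ℕ) (S : List A) → take a (take c S) ⊆ take c S
take-take-⊆ʳ a c S = subst (_⊆ take c S) (sym (take-take a c S)) (take⁺ (m⊓n≤n a c))

shortestPrefix-minimal : ShortestPrefix S W a → W ⊆ take b S → a ≤ b
shortestPrefix-minimal (_ , _ , shortest) σ = ≮⇒≥ (λ b<a → shortest _ b<a σ)

shortestPrefix-unique : ShortestPrefix S W a → ShortestPrefix S W b → a ≡ b
shortestPrefix-unique spa@(_ , σa , _) spb@(_ , σb , _) =
  ≤-antisym (shortestPrefix-minimal spa σb) (shortestPrefix-minimal spb σa)

shortestPrefix-rest-take : ShortestPrefix S W a → W ++ V ⊆ take c S → a ≤ c × V ⊆ take (c ∸ a) (drop a S)
shortestPrefix-rest-take {S = S} {W = W} {a = a} {c = c} spW τ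
  with a' , σ , ρ ← ⊆-++-split W τ =
  a≤c , subst (_ ⊆_) (drop-take a≤c S) (⊆-trans ρ (drop⁺-≥ a≤a'))
  where
  a≤a' : a ≤ a'
  a≤a' = shortestPrefix-minimal spW (⊆-trans σ (take-take-⊆ˡ a' c S))
  a≤c : a ≤ c
  a≤c = shortestPrefix-minimal spW (⊆-trans σ (take-take-⊆ʳ a' c S))

shortestPrefix-rest : ShortestPrefix S W a → W ++ V ⊆ S → V ⊆ drop a S
shortestPrefix-rest {S = S} spW τ = ⊆-trans (proj₂ (shortestPrefix-rest-take spW τ')) (take-⊆ _ _)
  where
  τ' : _ ⊆ take (length S) S
  τ' = subst (_ ⊆_) (sym (take-all (length S) S ≤-refl)) τ

shortestPrefix-++⁻ʳ : ShortestPrefix S W a → ShortestPrefix S (W ++ V) c →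
                      ShortestPrefix (drop a S) V (c ∸ a)
shortestPrefix-++⁻ʳ {S = S} {a = a} {c = c} spW@(_ , σW , _) (c≤ , τ , shortest)
  with a≤c , ρ ← shortestPrefix-rest-take spW τ =
  subst (c ∸ a ≤_) (sym (length-drop a S)) (∸-monoˡ-≤ a c≤) , ρ , tooShort
  where
  tooShort : ∀ m → m < c ∸ a → ¬ (_ ⊆ take m (drop a S))
  tooShort m m<c∸a ρ' = shortest (a + m) (subst (a + m <_) (m+[n∸m]≡n a≤c) (+-monoʳ-< a m<c∸a))
                          (subst (_ ⊆_) (sym (take-+ a S)) (++⁺ σW ρ'))

shortestPrefix-++ : ShortestPrefix S W a → ShortestPrefix (drop a S) V b →
                    ShortestPrefix S (W ++ V) (a + b)
shortestPrefix-++ {S = S} {a = a} {b = b} spW@(a≤ , σW , _) spV@(b≤ , σV , _) =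
  subst (a + b ≤_) (m+[n∸m]≡n a≤) (+-monoʳ-≤ a (subst (b ≤_) (length-drop a S) b≤)) ,
  subst (_ ⊆_) (sym (take-+ a S)) (++⁺ σW σV) ,
  tooShort
  where
  tooShort : ∀ m → m < a + b → ¬ (_ ⊆ take m S)
  tooShort m m<a+b τ with a≤m , ρ ← shortestPrefix-rest-take spW τ =
    <⇒≱ m<a+b (subst (a + b ≤_) (m+[n∸m]≡n a≤m) (+-monoʳ-≤ a (shortestPrefix-minimal spV ρ)))

IsLCS-length : IsLCS Z S T → IsLCS W S T → length Z ≡ length W
IsLCS-length (Z⊆S , Z⊆T , Zmax) (W⊆S , W⊆T , Wmax) = ≤-antisym (Wmax _ Z⊆S Z⊆T) (Zmax _ W⊆S W⊆T)

IsLCS-++⁻ʳ : ShortestPrefix S W a → ShortestPrefix T W b → IsLCS (W ++ V) S T →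
             IsLCS V (drop a S) (drop b T)
IsLCS-++⁻ʳ {S = S} {W = W} {a = a} {T = T} {b = b} {V = V} spS@(_ , σS , _) spT@(_ , σT , _)
           (WV⊆S , WV⊆T , WVmax) =
  shortestPrefix-rest spS WV⊆S , shortestPrefix-rest spT WV⊆T , Vmax
  where
  Vmax : ∀ V' → V' ⊆ drop a S → V' ⊆ drop b T → length V' ≤ length V
  Vmax V' ρS ρT = +-cancelˡ-≤ (length W) _ _ (subst₂ _≤_ (length-++ W) (length-++ W)
    (WVmax (W ++ V') (⊆-take++drop a σS ρS) (⊆-take++drop b σT ρT)))

IsLCS-++-graft : ShortestPrefix S W a → ShortestPrefix T W b → IsLCS (W ++ V) S T →
                 IsLCS Z (drop a S) (drop b T) → IsLCS (W ++ Z) S T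
IsLCS-++-graft {W = W} {V = V} {Z = Z} spS@(_ , σS , _) spT@(_ , σT , _) lcsWV lcsZ@(Z⊆S , Z⊆T , _) =
  ⊆-take++drop _ σS Z⊆S , ⊆-take++drop _ σT Z⊆T ,
  λ U U⊆S U⊆T → subst (length U ≤_) |WV|≡|WZ| (proj₂ (proj₂ lcsWV) U U⊆S U⊆T)
  where
  |WV|≡|WZ| : length (W ++ V) ≡ length (W ++ Z)
  |WV|≡|WZ| = begin
    length (W ++ V)         ≡⟨ length-++ W ⟩
    length W + length V     ≡⟨ cong (length W +_) (IsLCS-length (IsLCS-++⁻ʳ spS spT lcsWV) lcsZ) ⟩
    length W + length Z     ≡⟨ sym (length-++ W) ⟩
    length (W ++ Z)         ∎
    where open ≡-Reasoning

Linked-∷⁺ : {R : A → A → Set} → All (R s) S → Linked R S → Linked R (s ∷ S)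
Linked-∷⁺ [] [] = [-]
Linked-∷⁺ (r ∷ _) l = r ∷ l

Linked-∷⁻ : Linked _<_ (j ∷ xs) → All (j <_) xs
Linked-∷⁻ [-] = []
Linked-∷⁻ (r ∷ l) = Linked⇒All <-trans r l

Linked-++⁻ʳ : {R : A → A → Set} (S : List A) → Linked R (S ++ T) → Linked R T
Linked-++⁻ʳ [] l = l
Linked-++⁻ʳ (_ ∷ S) l = Linked-++⁻ʳ S (Linked.tail l)

Linked-graft : {R : A → A → Set} (S : List A) → Linked R (S ++ s ∷ T) → Linked R (s ∷ V) →
               Linked R (S ++ s ∷ V)
Linked-graft [] _ l = l
Linked-graft (_ ∷ []) (r ∷ _) l = r ∷ l
Linked-graft (_ ∷ s' ∷ S) (r ∷ l') l = r ∷ Linked-graft (s' ∷ S) l' l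

<lex-++ˡ : (zs : List ℕ) → xs <lex ys → (zs ++ xs) <lex (zs ++ ys)
<lex-++ˡ [] lt = lt
<lex-++ˡ (_ ∷ zs) lt = next refl (<lex-++ˡ zs lt)

<lex⇒take-≡ : xs <lex ys → (∀ k' a b → k' < k → xs ! k' ≡ just a → ys ! k' ≡ just b → ¬ (a < b)) →
              xs ! k ≡ just p → take k xs ≡ take k ys
<lex⇒take-≡ {k = zero} _ _ _ = refl
<lex⇒take-≡ {k = suc k} halt _ ()
<lex⇒take-≡ {k = suc k} (this a<b) noIncrease _ = ⊥-elim (noIncrease 0 _ _ (s≤s z≤n) refl refl a<b)
<lex⇒take-≡ {x ∷ _} {k = suc k} (next refl lt) noIncrease Pk =
  cong (x ∷_) (<lex⇒take-≡ lt (λ k' a b → noIncrease (suc k') a b ∘′ s≤s) Pk)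

Greedy : List A → ℕ → List ℕ → Set
Greedy Y j' P = ∀ k p Z → P ! k ≡ just p → sel Y (take (suc k) P) ≡ just Z →
  ShortestPrefix (drop j' Y) Z (suc p ∸ j')

greedy-at : (Y : List A) (U : List ℕ) → Greedy Y j' (U ++ p ∷ V) → sel Y (U ++ [ p ]) ≡ just W →
            ShortestPrefix (drop j' Y) W (suc p ∸ j')
greedy-at Y U greedy sW =
  greedy (length U) _ _ (!-++ʳ {k = 0} U) (trans (cong (sel Y) (take-++ʳ {m = 1} U)) sW)

greedy-++⁻ˡ : (Y : List A) (T : List ℕ) → Greedy Y j' (T ++ V) → Greedy Y j' T
greedy-++⁻ˡ Y T greedy k p Z Tk sZ = greedy k p Z
  (trans (!-++ˡ T (!-< {S = T} Tk)) Tk)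
  (trans (cong (sel Y) (take-++ˡ T (!-< {S = T} Tk))) sZ)

greedy-++⁻ʳ : (Y : List A) (T : List ℕ) → Greedy Y 0 (T ++ V) → sel Y T ≡ just W → ShortestPrefix Y W m →
              Greedy Y m V
greedy-++⁻ʳ {V = V} Y T greedy sW spW k p Z Vk sZ = shortestPrefix-++⁻ʳ spW (greedy (k + length T) p _
  (trans (!-++ʳ T) Vk)
  (trans (cong (sel Y) (take-++ʳ {m = suc k} T)) (sel-++⁺ Y T (take (suc k) V) sW sZ)))

greedy-++ : (Y : List A) (T : List ℕ) → Greedy Y 0 T → sel Y T ≡ just W → ShortestPrefix Y W m →
            Greedy Y m V → All (m ≤_) V → Greedy Y 0 (T ++ V)
greedy-++ {W = W} {V = V} Y T greedyT sW spW greedyV m≤V k p Z TVk sZ with k <? length T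
... | yes k<|T| = greedyT k p Z
  (trans (sym (!-++ˡ T k<|T|)) TVk)
  (trans (cong (sel Y) (sym (take-++ˡ T k<|T|))) sZ)
... | no k≮|T| with i ← k ∸ length T | refl ← m∸n+n≡m (≮⇒≥ k≮|T|)
  with Z' , sZ' , refl ← sel-++⁻ʳ Y T (take (suc i) V) sW
                            (trans (cong (sel Y) (sym (take-++ʳ {m = suc i} T))) sZ) =
  subst (ShortestPrefix Y (W ++ Z')) (m+[n∸m]≡n (m≤n⇒m≤1+n (All-! m≤V Vi)))
    (shortestPrefix-++ spW (greedyV i p Z' Vi sZ'))
  where
  Vi : V ! i ≡ just p
  Vi = trans (sym (!-++ʳ T)) TVk

module Suffix {A : Set} {X Y W : List A} {U Q : List ℕ} {j mX mY : ℕ}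
  (isLCSPos : IsLCSPos X Y 0 (U ++ j ∷ Q)) (sW : sel Y (U ++ [ j ]) ≡ just W)
  (spX : ShortestPrefix X W mX) (spY : ShortestPrefix Y W mY) where

  private
    inRange : All (λ i → 0 ≤ i × i < length Y) (U ++ j ∷ Q)
    inRange = proj₁ isLCSPos

    linked : Linked _<_ (U ++ j ∷ Q)
    linked = proj₁ (proj₂ isLCSPos)

    greedy : Greedy Y 0 (U ++ j ∷ Q)
    greedy = proj₂ (proj₂ (proj₂ isLCSPos))

    greedy-assoc : Greedy Y 0 ((U ++ [ j ]) ++ Q)
    greedy-assoc = subst (Greedy Y 0) (sym (++-assoc U [ j ] Q)) greedy

    mY≡1+j : mY ≡ suc j
    mY≡1+j = shortestPrefix-unique spY (greedy-at {j' = 0} Y U greedy sW)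

    lcs-suffix : ∃ λ B → sel Y Q ≡ just B × IsLCS (W ++ B) X Y
    lcs-suffix with Z , sZ , lcsZ ← proj₁ (proj₂ (proj₂ isLCSPos))
      with B , sB , refl ← sel-++⁻ʳ Y (U ++ [ j ]) Q sW (trans (cong (sel Y) (++-assoc U [ j ] Q)) sZ) =
      B , sB , lcsZ

  suffix-isLCSPos : IsLCSPos (drop mX X) Y mY Q
  suffix-isLCSPos with B , sB , lcsWB ← lcs-suffix =
    All.zip (subst (λ m → All (m ≤_) Q) (sym mY≡1+j) (Linked-∷⁻ (Linked-++⁻ʳ U linked)) ,
             All.map proj₂ (All.tail (All.++⁻ʳ U inRange))) ,
    Linked.tail (Linked-++⁻ʳ U linked) ,
    (B , sB , IsLCS-++⁻ʳ spX spY lcsWB) ,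
    greedy-++⁻ʳ Y (U ++ [ j ]) greedy-assoc sW spY

  graft-isLCSPos : {Q' : List ℕ} → IsLCSPos (drop mX X) Y mY Q' → IsLCSPos X Y 0 (U ++ j ∷ Q')
  graft-isLCSPos {Q'} (inRange' , linked' , (Z' , sZ' , lcsZ') , greedy')
    with _ , _ , lcsWB ← lcs-suffix =
    All.++⁺ (All.++⁻ˡ U inRange) (All.head (All.++⁻ʳ U inRange) ∷ All.map (λ r → z≤n , proj₂ r) inRange') ,
    Linked-graft U linked (Linked-∷⁺ (All.map (λ r → subst (_≤ _) mY≡1+j (proj₁ r)) inRange') linked') ,
    (W ++ Z' ,
     trans (cong (sel Y) (sym (++-assoc U [ j ] Q'))) (sel-++⁺ Y (U ++ [ j ]) Q' sW sZ') ,
     IsLCS-++-graft spX spY lcsWB lcsZ') ,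
    subst (Greedy Y 0) (++-assoc U [ j ] Q')
      (greedy-++ Y (U ++ [ j ]) (greedy-++⁻ˡ {j' = 0} Y (U ++ [ j ]) greedy-assoc) sW spY
                 greedy' (All.map proj₁ inRange'))

lemma2 : {A : Set} (X Y : List A) (P P⋆ : List ℕ) →
    Consecutive X Y 0 P P⋆ →
    (k j : ℕ) → IsKStar P P⋆ k j →
    (W : List A) → sel Y (take k P ++ (j ∷ [])) ≡ just W →
    (mX mY : ℕ) → ShortestPrefix X W mX → ShortestPrefix Y W mY →
    ∃ (λ Q → IsFirst (drop mX X) Y mY Q × P⋆ ≡ take k P ++ (j ∷ []) ++ Q)
lemma2 X Y P P⋆ (_ , isLCSPos⋆ , P<P⋆ , nothingBetween) k j ((p , Pk , P⋆k , p<j) , noIncrease)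
       W sW mX mY spX spY =
  Q , (suffix-isLCSPos , first) , P⋆≡
  where
  U Q : List ℕ
  U = take k P
  Q = drop (suc k) P⋆

  P⋆≡ : P⋆ ≡ U ++ j ∷ Q
  P⋆≡ = trans (!-split P⋆k) (cong (_++ j ∷ Q) (sym (<lex⇒take-≡ P<P⋆ noIncrease Pk)))

  open Suffix (subst (IsLCSPos X Y 0) P⋆≡ isLCSPos⋆) sW spX spY

  first : ∀ Q' → IsLCSPos (drop mX X) Y mY Q' → ¬ (Q' <lex Q)
  first Q' isLCSPos' Q'<Q = nothingBetween (U ++ j ∷ Q') (graft-isLCSPos isLCSPos')
    ( subst (_<lex (U ++ j ∷ Q')) (sym (!-split Pk)) (<lex-++ˡ U (this p<j))
    , subst ((U ++ j ∷ Q') <lex_) (sym P⋆≡) (<lex-++ˡ U (next refl Q'<Q)))
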